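{- Let $q\ge 1$ and let $w$ be a word of length $2q$ over an alphabet $\Sigma$ with exactly $q$ distinct letters, each of which occurs exactly twice in $w$. Then $SP(w)\le 2^{q+1}-2$.
   Context: A scattered subword of $w$ is a (not necessarily contiguous) subsequence of $w$. A palindrome is a word equal to its reversal. $SP(w)$ is the number of distinct non-empty palindromes that are scattered subwords of $w$. -}

module Defs where

open import Data.Nat using (ℕ)
open import Data.List using (List; []; _∷_; _++_; map; reverse; filter; length; deduplicate)
import Data.List.Properties as LP
open import Relation.Binary.Definitions using (DecidableEquality)
open import Relation.Binary.PropositionalEquality using (_≡_)
open import Relation.Nullary using (¬_; ¬?; _×-dec_)
open import Data.Product using (_×_)

subwords : ∀ {A : Set} → List A → List (List A)
subwords []       = [] ∷ []
subwords (x ∷ xs) = subwords xs ++ map (x ∷_) (subwords xs)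

IsPalindrome : ∀ {A : Set} → List A → Set
IsPalindrome u = u ≡ reverse u

NonEmpty : ∀ {A : Set} → List A → Set
NonEmpty u = ¬ (u ≡ [])

module _ {A : Set} (_≟_ : DecidableEquality A) where

  private
    _≟L_ : DecidableEquality (List A)
    _≟L_ = LP.≡-dec _≟_

  SP : List A → ℕ
  SP w = length (deduplicate _≟L_
           (filter (λ u → ¬? (u ≟L []) ×-dec (u ≟L reverse u)) (subwords w)))

  occ : A → List A → ℕ
  occ a w = length (filter (a ≟_) w)

-- Induction on |w|, for the stronger statement SP(w) + 2 ≤ (|S| + 2)·2^|D|
-- whenever every letter of w occurs at most twice, lies in S or D, and lies in
-- D if it occurs twice.  If the first letter x of w does not recur, the only
-- new palindrome is x itself.  Otherwise w = x I x R with x ∉ I, and a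
-- palindrome of w is a palindrome of I R, or u x (reverse u) with u a subword
-- of I all of whose letters occur in R, or x u x with u empty or a palindrome
-- of I.  Hence SP(w) ≤ SP(I R) + 1 + SP(I) + 2^|I′|, where I′ keeps the letters
-- of I that recur in R; these occur once in I, so they move from D to S in the
-- bound for I, and the exponential count 2^|I′| is paid for by the doubled x.

module Submission where

open import Defs
open import Data.Nat using (ℕ; _≤_; _*_; _∸_; _^_; _+_)
open import Data.List using (List; length; deduplicate)
open import Data.List.Membership.Propositional using (_∈_)
open import Relation.Binary.Definitions using (DecidableEquality)
open import Relation.Binary.PropositionalEquality using (_≡_)

open import Data.Nat using (suc; _<_; z≤n; s≤s)
open import Data.Nat.Properties
open import Data.Nat.Solver using (module +-*-Solver)
open import Data.Nat.Induction using (<-wellFounded)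
open import Induction.WellFounded using (Acc; acc)
open import Data.Product using (∃₂; _×_; _,_; proj₁; proj₂)
open import Data.Sum using (_⊎_; inj₁; inj₂; [_,_]′)
import Data.Sum as Sum
open import Function using (_∘_)
open import Relation.Nullary using (yes; no; ¬?; _×-dec_; contradiction)
open import Relation.Unary using (Decidable)
open import Relation.Unary.Properties using (∁?)
open import Relation.Binary.PropositionalEquality
  using (refl; sym; trans; cong; cong₂; subst; _≢_; module ≡-Reasoning)
open import Data.List using ([]; _∷_; _++_; [_]; map; reverse; filter)
import Data.List.Properties as List
open import Data.List.Membership.Propositional using (_∉_)
open import Data.List.Membership.Propositional.Properties
  using (∈-++⁺ˡ; ∈-++⁺ʳ; ∈-++⁻; ∈-map⁺; ∈-map⁻; ∈-filter⁺; ∈-filter⁻)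
open import Data.List.Relation.Unary.Any using (here; there)
import Data.List.Relation.Unary.Any as Any
import Data.List.Relation.Unary.Any.Properties as Anyₚ
import Data.List.Relation.Unary.All as All
open import Data.List.Relation.Unary.All.Properties using (¬Any⇒All¬)
open import Data.List.Relation.Unary.AllPairs using ([]; _∷_)
open import Data.List.Relation.Unary.Unique.Propositional using (Unique)
import Data.List.Relation.Unary.Unique.DecPropositional.Properties as Unique
open import Data.List.Relation.Binary.Sublist.Propositional
  using (_⊆_; []; _∷_; _∷ʳ_; lookup; minimum; ⊆-refl)
open import Data.List.Relation.Binary.Sublist.Propositional.Properties
  using (++⁺; ++⁺ˡ; ++⁺ʳ; filter⁺; filter-⊆; length-mono-≤)

private
  variable
    A : Set

bound : ℕ → ℕ → ℕ
bound s d = (s + 2) * 2 ^ d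

bound-mono-≤ : ∀ {s s′ d d′} → s ≤ s′ → d ≤ d′ → bound s d ≤ bound s′ d′
bound-mono-≤ s≤s′ d≤d′ = *-mono-≤ (+-monoˡ-≤ 2 s≤s′) (^-monoʳ-≤ 2 d≤d′)

bound-monoˡ-< : ∀ {s s′ d d′} → s < s′ → d ≤ d′ → bound s d < bound s′ d′
bound-monoˡ-< {s} {s′} {d} {d′} s<s′ d≤d′ = begin-strict
  bound s d              <⟨ m<n+m (bound s d) (m^n>0 2 d) ⟩
  bound (suc s) d        ≤⟨ bound-mono-≤ s<s′ d≤d′ ⟩
  bound s′ d′            ∎
  where open ≤-Reasoning

bound-suc : ∀ s d → bound s (suc d) ≡ bound s d + bound s d
bound-suc s d = solve 2 (λ s e → (s :+ con 2) :* (con 2 :* e) := (s :+ con 2) :* e :+ (s :+ con 2) :* e)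
                  refl s (2 ^ d)
  where open +-*-Solver

bound-pos : ∀ s d → 0 < bound s d
bound-pos s d = *-mono-≤ (≤-trans (s≤s z≤n) (m≤n+m 2 s)) (m^n>0 2 d)

bound-monoʳ-< : ∀ {s s′ d d′} → s ≤ s′ → d < d′ → bound s d < bound s′ d′
bound-monoʳ-< {s} {s′} {d} {d′} s≤s′ d<d′ = begin-strict
  bound s d              <⟨ m<m+n (bound s d) (bound-pos s d) ⟩
  bound s d + bound s d  ≡⟨ bound-suc s d ⟨
  bound s (suc d)        ≤⟨ bound-mono-≤ s≤s′ d<d′ ⟩
  bound s′ d′            ∎
  where open ≤-Reasoning

-- Counting k letters as doubled rather than single pays for 2 ^ k extra
-- palindromes.
bound-transfer : ∀ s k e → bound (s + k) e + 2 ^ k ≤ bound s (k + e) + 1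
bound-transfer s 0       e rewrite +-identityʳ s = ≤-refl
bound-transfer s (suc k) e = begin
  bound (s + suc k) e + 2 ^ suc k
    ≡⟨ solve 4 (λ s k E K → (s :+ (con 1 :+ k) :+ con 2) :* E :+ con 2 :* K
                          := ((s :+ k :+ con 2) :* E :+ K) :+ (E :+ K)) refl s k E K ⟩
  (bound (s + k) e + K) + (E + K)
    ≤⟨ +-mono-≤ (bound-transfer s k e) (+-mono-≤ E≤M (≤-trans K≤M (m≤m+n M 0))) ⟩
  (bound s (k + e) + 1) + 2 * M
    ≤⟨ +-monoʳ-≤ (bound s (k + e) + 1) (*-monoˡ-≤ M (m≤n+m 2 s)) ⟩
  (bound s (k + e) + 1) + (s + 2) * M
    ≡⟨ solve 2 (λ B C → (B :+ con 1) :+ C := (B :+ C) :+ con 1) refl (bound s (k + e)) ((s + 2) * M) ⟩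
  (bound s (k + e) + bound s (k + e)) + 1
    ≡⟨ cong (_+ 1) (bound-suc s (k + e)) ⟨
  bound s (suc k + e) + 1 ∎
  where
    open ≤-Reasoning
    open +-*-Solver
    E = 2 ^ e
    K = 2 ^ k
    M = 2 ^ (k + e)
    E≤M : E ≤ M
    E≤M = ^-monoʳ-≤ 2 (m≤n+m e k)
    K≤M : K ≤ M
    K≤M = ^-monoʳ-≤ 2 (m≤m+n k e)

bound-doubled : ∀ {s d₁ d₂ c X Y Z} →
                X + 2 ≤ bound s (d₁ + d₂) → Y + 2 ≤ bound (s + d₁) d₂ → c ≤ d₁ →
                Z ≤ X + suc (Y + 2 ^ c) → Z + 2 ≤ bound s (suc (d₁ + d₂))
bound-doubled {s} {d₁} {d₂} {c} {X} {Y} {Z} X≤ Y≤ c≤d₁ Z≤ = ≤-pred (begin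
  suc (Z + 2)                          ≤⟨ s≤s (+-monoˡ-≤ 2 Z≤) ⟩
  suc (X + suc (Y + 2 ^ c) + 2)        ≡⟨ solve 3 (λ X Y C → con 1 :+ (X :+ (con 1 :+ (Y :+ C)) :+ con 2)
                                                         := (X :+ con 2) :+ ((Y :+ con 2) :+ C)) refl X Y (2 ^ c) ⟩
  (X + 2) + ((Y + 2) + 2 ^ c)          ≤⟨ +-mono-≤ X≤ (+-mono-≤ Y≤ (^-monoʳ-≤ 2 c≤d₁)) ⟩
  B + (bound (s + d₁) d₂ + 2 ^ d₁)     ≤⟨ +-monoʳ-≤ B (bound-transfer s d₁ d₂) ⟩
  B + (B + 1)                          ≡⟨ solve 1 (λ B → B :+ (B :+ con 1) := con 1 :+ (B :+ B)) refl B ⟩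
  suc (B + B)                          ≡⟨ cong suc (bound-suc s (d₁ + d₂)) ⟨
  suc (bound s (suc (d₁ + d₂)))        ∎)
  where
    open ≤-Reasoning
    open +-*-Solver
    B = bound s (d₁ + d₂)

Unique-length-≤ : DecidableEquality A → ∀ {xs ys : List A} →
                  Unique xs → (∀ {a} → a ∈ xs → a ∈ ys) → length xs ≤ length ys
Unique-length-≤ _≟_ {[]}     _             _     = z≤n
Unique-length-≤ _≟_ {x ∷ xs} {ys} (x∉xs ∷ !xs) xs⊆ys =
  ≤-trans (s≤s (Unique-length-≤ _≟_ !xs xs⊆ys-x))
          (List.filter-notAll ≢x? ys (Any.map (λ x≡y x≢y → x≢y x≡y) (xs⊆ys (here refl))))
  where
    ≢x? = λ y → ¬? (x ≟ y)
    xs⊆ys-x : ∀ {a} → a ∈ xs → a ∈ filter ≢x? ys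
    xs⊆ys-x a∈xs = ∈-filter⁺ ≢x? (xs⊆ys (there a∈xs)) (All.lookup x∉xs a∈xs)

length-filter-∁ : ∀ {P : A → Set} (P? : Decidable P) xs →
                  length (filter P? xs) + length (filter (∁? P?) xs) ≡ length xs
length-filter-∁ P? []       = refl
length-filter-∁ P? (x ∷ xs) with P? x
... | yes _ = cong suc (length-filter-∁ P? xs)
... | no  _ = trans (+-suc _ _) (cong suc (length-filter-∁ P? xs))

∈-∃++-first : DecidableEquality A → ∀ {x : A} {w} → x ∈ w →
              ∃₂ λ I R → w ≡ I ++ x ∷ R × x ∉ I
∈-∃++-first _≟_ (here refl) = [] , _ , refl , λ ()
∈-∃++-first _≟_ {x} {y ∷ w} (there x∈w) with x ≟ y
... | yes refl = [] , w , refl , λ ()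
... | no  x≢y with I , R , refl , x∉I ← ∈-∃++-first _≟_ x∈w =
  y ∷ I , R , refl , λ { (here x≡y) → x≢y x≡y ; (there x∈I) → x∉I x∈I }

⊆-++⁻ : ∀ (u : List A) {v p} → p ⊆ u ++ v → ∃₂ λ p₁ p₂ → p ≡ p₁ ++ p₂ × p₁ ⊆ u × p₂ ⊆ v
⊆-++⁻ []      p⊆v = [] , _ , refl , [] , p⊆v
⊆-++⁻ (x ∷ u) (.x ∷ʳ p⊆uv) with p₁ , p₂ , refl , p₁⊆u , p₂⊆v ← ⊆-++⁻ u p⊆uv =
  p₁ , p₂ , refl , x ∷ʳ p₁⊆u , p₂⊆v
⊆-++⁻ (x ∷ u) (refl ∷ p⊆uv) with p₁ , p₂ , refl , p₁⊆u , p₂⊆v ← ⊆-++⁻ u p⊆uv =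
  x ∷ p₁ , p₂ , refl , refl ∷ p₁⊆u , p₂⊆v

⊆-filter⁺ : ∀ {P : A → Set} (P? : Decidable P) {p w} → p ⊆ w → All.All P p → p ⊆ filter P? w
⊆-filter⁺ P? p⊆w Pp = subst (_⊆ _) (List.filter-all P? Pp) (filter⁺ P? P? (λ { refl Pa → Pa }) p⊆w)

reverse-++-∷ : ∀ (u : List A) x v → reverse (u ++ x ∷ v) ≡ reverse v ++ x ∷ reverse u
reverse-++-∷ u x v = trans (List.++-ʳ++ u) (List.ʳ++-defn v)

++-∷-injective : ∀ {x : A} {u v u′ v′} → x ∉ u → x ∉ u′ →
                 u ++ x ∷ v ≡ u′ ++ x ∷ v′ → u ≡ u′ × v ≡ v′
++-∷-injective {u = []}    {u′ = []}     _   _    eq = refl , List.∷-injectiveʳ eq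
++-∷-injective {u = []}    {u′ = _ ∷ _}  _   x∉u′ eq = contradiction (here (List.∷-injectiveˡ eq)) x∉u′
++-∷-injective {u = _ ∷ _} {u′ = []}     x∉u _    eq =
  contradiction (here (sym (List.∷-injectiveˡ eq))) x∉u
++-∷-injective {u = a ∷ u} {u′ = b ∷ u′} x∉u x∉u′ eq
  with refl , v≡v′ ← ++-∷-injective (x∉u ∘ there) (x∉u′ ∘ there) (List.∷-injectiveʳ eq)
  rewrite List.∷-injectiveˡ eq = refl , v≡v′

∉-reverse : ∀ {x : A} {u} → x ∉ u → x ∉ reverse u
∉-reverse x∉u = x∉u ∘ Anyₚ.reverse⁻

∈-subwords⁻ : ∀ (w : List A) {p} → p ∈ subwords w → p ⊆ w
∈-subwords⁻ []      (here refl) = []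
∈-subwords⁻ (x ∷ w) p∈ with ∈-++⁻ (subwords w) p∈
... | inj₁ p∈w = x ∷ʳ ∈-subwords⁻ w p∈w
... | inj₂ p∈x∷w with _ , p′∈w , refl ← ∈-map⁻ (x ∷_) p∈x∷w = refl ∷ ∈-subwords⁻ w p′∈w

∈-subwords⁺ : ∀ {p w : List A} → p ⊆ w → p ∈ subwords w
∈-subwords⁺ []                      = here refl
∈-subwords⁺ {w = x ∷ w} (.x ∷ʳ p⊆w) = ∈-++⁺ˡ (∈-subwords⁺ p⊆w)
∈-subwords⁺ {w = x ∷ w} (refl ∷ p⊆w) = ∈-++⁺ʳ (subwords w) (∈-map⁺ (x ∷_) (∈-subwords⁺ p⊆w))

length-subwords : ∀ (w : List A) → length (subwords w) ≡ 2 ^ length w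
length-subwords []      = refl
length-subwords (x ∷ w) = begin
  length (subwords w ++ map (x ∷_) (subwords w))   ≡⟨ List.length-++ (subwords w) ⟩
  n + length (map (x ∷_) (subwords w))             ≡⟨ cong (n +_) (List.length-map (x ∷_) (subwords w)) ⟩
  n + n                                            ≡⟨ cong (λ m → m + m) (length-subwords w) ⟩
  2 ^ length w + 2 ^ length w                      ≡⟨ cong (2 ^ length w +_) (+-identityʳ (2 ^ length w)) ⟨
  2 ^ length (x ∷ w)                               ∎
  where
    open ≡-Reasoning
    n = length (subwords w)

palindrome-mirror : ∀ {x : A} {u v} → x ∉ u → x ∉ v → IsPalindrome (u ++ x ∷ v) → v ≡ reverse u
palindrome-mirror {x = x} {u} {v} x∉u x∉v pal =
  proj₂ (++-∷-injective x∉u (∉-reverse x∉v) (trans pal (reverse-++-∷ u x v)))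

palindrome-∷-fresh : ∀ {x : A} {t} → x ∉ t → IsPalindrome (x ∷ t) → t ≡ []
palindrome-∷-fresh = palindrome-mirror {u = []} (λ ())

palindrome-wrap : ∀ {x : A} {u v} → x ∉ v → IsPalindrome (x ∷ u ++ x ∷ v) →
                  v ≡ [] × IsPalindrome u
palindrome-wrap {x = x} {u} {v} x∉v pal = v≡[] , List.++-cancelʳ [ x ] u (reverse u) u∷x≡
  where
    open ≡-Reasoning
    split : [] ≡ reverse v × u ++ x ∷ v ≡ reverse u ++ [ x ]
    split = ++-∷-injective (λ ()) (∉-reverse x∉v) (begin
      x ∷ u ++ x ∷ v                     ≡⟨ pal ⟩
      reverse ((x ∷ u) ++ x ∷ v)         ≡⟨ reverse-++-∷ (x ∷ u) x v ⟩
      reverse v ++ x ∷ reverse (x ∷ u)   ≡⟨ cong (λ r → reverse v ++ x ∷ r) (List.unfold-reverse x u) ⟩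
      reverse v ++ x ∷ reverse u ++ [ x ] ∎)
    v≡[] : v ≡ []
    v≡[] = List.reverse-injective {x = v} {y = []} (sym (proj₁ split))
    u∷x≡ : u ++ [ x ] ≡ reverse u ++ [ x ]
    u∷x≡ = subst (λ v → u ++ x ∷ v ≡ reverse u ++ [ x ]) v≡[] (proj₂ split)

module _ {A : Set} (_≟_ : DecidableEquality A) where

  open import Data.List.Membership.DecPropositional _≟_ using (_∈?_)

  private
    _≟ₗ_ : DecidableEquality (List A)
    _≟ₗ_ = List.≡-dec _≟_

  -- SP w is definitionally the length of palindromes w.
  palindromes : List A → List (List A)
  palindromes w = deduplicate _≟ₗ_ (filter (λ u → ¬? (u ≟ₗ []) ×-dec (u ≟ₗ reverse u)) (subwords w))

  PalindromicSubword : List A → List A → Set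
  PalindromicSubword w p = p ⊆ w × NonEmpty p × IsPalindrome p

  ∈-palindromes⁻ : ∀ {w p} → p ∈ palindromes w → PalindromicSubword w p
  ∈-palindromes⁻ {w} p∈
    with p∈sw , p≢[] , pal ← ∈-filter⁻ _ {xs = subwords w} (Anyₚ.deduplicate⁻ _≟ₗ_ p∈) =
    ∈-subwords⁻ w p∈sw , p≢[] , pal

  ∈-palindromes⁺ : ∀ {w p} → PalindromicSubword w p → p ∈ palindromes w
  ∈-palindromes⁺ (p⊆w , p≢[] , pal) =
    Anyₚ.deduplicate⁺ _≟ₗ_ (λ p≡q q≡r → trans q≡r (sym p≡q))
                      (∈-filter⁺ _ (∈-subwords⁺ p⊆w) (p≢[] , pal))

  palindrome-∈ : ∀ {w p} → p ⊆ w → IsPalindrome p → p ∈ [] ∷ palindromes w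
  palindrome-∈ {p = []}    _   _   = here refl
  palindrome-∈ {p = _ ∷ _} p⊆w pal = there (∈-palindromes⁺ (p⊆w , (λ ()) , pal))

  SP≤length : ∀ {w} (ps : List (List A)) →
              (∀ {p} → PalindromicSubword w p → p ∈ ps) → SP _≟_ w ≤ length ps
  SP≤length {w} ps complete =
    Unique-length-≤ _≟ₗ_ (Unique.deduplicate-! _≟ₗ_ _) (complete ∘ ∈-palindromes⁻ {w})

  SP-∷-fresh : ∀ {x v} → x ∉ v → SP _≟_ (x ∷ v) ≤ suc (SP _≟_ v)
  SP-∷-fresh {x} {v} x∉v = SP≤length ([ x ] ∷ palindromes v) complete
    where
      complete : ∀ {p} → PalindromicSubword (x ∷ v) p → p ∈ [ x ] ∷ palindromes v
      complete (.x ∷ʳ p⊆v , p≢[] , pal) = there (∈-palindromes⁺ (p⊆v , p≢[] , pal))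
      complete (refl ∷ t⊆v , _ , pal) rewrite palindrome-∷-fresh (x∉v ∘ lookup t⊆v) pal = here refl

  SP-doubled : ∀ {x I R} → x ∉ I → x ∉ R →
               SP _≟_ (x ∷ I ++ x ∷ R) ≤ SP _≟_ (I ++ R) + suc (SP _≟_ I + 2 ^ length (filter (_∈? R) I))
  SP-doubled {x} {I} {R} x∉I x∉R =
    subst (SP _≟_ (x ∷ I ++ x ∷ R) ≤_) length-candidates (SP≤length candidates complete)
    where
      wrap mirror : List A → List A
      wrap u   = x ∷ u ++ [ x ]
      mirror u = u ++ x ∷ reverse u

      shared : List A
      shared = filter (_∈? R) I

      wrapped mirrored candidates : List (List A)
      wrapped    = map wrap ([] ∷ palindromes I)
      mirrored   = map mirror (subwords shared)
      candidates = palindromes (I ++ R) ++ wrapped ++ mirrored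

      length-candidates : length candidates ≡ SP _≟_ (I ++ R) + suc (SP _≟_ I + 2 ^ length shared)
      length-candidates = begin
        length candidates
          ≡⟨ List.length-++ (palindromes (I ++ R)) ⟩
        SP _≟_ (I ++ R) + length (wrapped ++ mirrored)
          ≡⟨ cong (SP _≟_ (I ++ R) +_) (List.length-++ wrapped) ⟩
        SP _≟_ (I ++ R) + (length wrapped + length mirrored)
          ≡⟨ cong₂ (λ m n → SP _≟_ (I ++ R) + (m + n)) (List.length-map wrap ([] ∷ palindromes I))
                   (trans (List.length-map mirror (subwords shared)) (length-subwords shared)) ⟩
        SP _≟_ (I ++ R) + suc (SP _≟_ I + 2 ^ length shared) ∎
        where open ≡-Reasoning

      x∉ : ∀ {u w} → u ⊆ w → x ∉ w → x ∉ u
      x∉ u⊆w x∉w = x∉w ∘ lookup u⊆w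

      x∉IR : x ∉ I ++ R
      x∉IR = [ x∉I , x∉R ]′ ∘ ∈-++⁻ I

      mirrored-∈ : ∀ {u v} → u ⊆ I → v ⊆ R → IsPalindrome (u ++ x ∷ v) → u ++ x ∷ v ∈ mirrored
      mirrored-∈ {u} {v} u⊆I v⊆R pal =
        subst (λ v → u ++ x ∷ v ∈ mirrored) (sym v≡)
              (∈-map⁺ mirror (∈-subwords⁺ (⊆-filter⁺ (_∈? R) u⊆I u⊆R)))
        where
          v≡ : v ≡ reverse u
          v≡ = palindrome-mirror (x∉ u⊆I x∉I) (x∉ v⊆R x∉R) pal
          u⊆R : All.All (_∈ R) u
          u⊆R = All.tabulate (λ a∈u → lookup v⊆R (subst (_ ∈_) (sym v≡) (Anyₚ.reverse⁺ a∈u)))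

      wrapped-∈ : ∀ {u v} → u ⊆ I → v ⊆ R → IsPalindrome (x ∷ u ++ x ∷ v) → x ∷ u ++ x ∷ v ∈ wrapped
      wrapped-∈ u⊆I v⊆R pal with refl , palᵤ ← palindrome-wrap (x∉ v⊆R x∉R) pal =
        ∈-map⁺ wrap (palindrome-∈ u⊆I palᵤ)

      single-∈ : ∀ {t} → t ⊆ I ++ R → IsPalindrome (x ∷ t) → x ∷ t ∈ mirrored
      single-∈ t⊆IR pal rewrite palindrome-∷-fresh (x∉ t⊆IR x∉IR) pal =
        ∈-map⁺ mirror (∈-subwords⁺ (minimum shared))

      complete : ∀ {p} → PalindromicSubword (x ∷ I ++ x ∷ R) p → p ∈ candidates
      complete (.x ∷ʳ p⊆ , p≢[] , pal) with ⊆-++⁻ I p⊆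
      ... | _ , _ , refl , u⊆I , .x ∷ʳ v⊆R = ∈-++⁺ˡ (∈-palindromes⁺ (++⁺ u⊆I v⊆R , p≢[] , pal))
      ... | _ , _ , refl , u⊆I , refl ∷ v⊆R =
        ∈-++⁺ʳ (palindromes (I ++ R)) (∈-++⁺ʳ wrapped (mirrored-∈ u⊆I v⊆R pal))
      complete (refl ∷ t⊆ , _ , pal) with ⊆-++⁻ I t⊆
      ... | _ , _ , refl , u⊆I , .x ∷ʳ v⊆R =
        ∈-++⁺ʳ (palindromes (I ++ R)) (∈-++⁺ʳ wrapped (single-∈ (++⁺ u⊆I v⊆R) pal))
      ... | _ , _ , refl , u⊆I , refl ∷ v⊆R =
        ∈-++⁺ʳ (palindromes (I ++ R)) (∈-++⁺ˡ (wrapped-∈ u⊆I v⊆R pal))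

  occ-++ : ∀ a u v → occ _≟_ a (u ++ v) ≡ occ _≟_ a u + occ _≟_ a v
  occ-++ a u v = trans (cong length (List.filter-++ (a ≟_) u v)) (List.length-++ (filter (a ≟_) u))

  occ-∷ : ∀ a w → occ _≟_ a (a ∷ w) ≡ suc (occ _≟_ a w)
  occ-∷ a w = cong length (List.filter-accept (a ≟_) refl)

  occ-mono : ∀ {a u v} → u ⊆ v → occ _≟_ a u ≤ occ _≟_ a v
  occ-mono {a} u⊆v = length-mono-≤ (filter⁺ (a ≟_) (a ≟_) (λ { refl a≡b → a≡b }) u⊆v)

  ∈⇒occ>0 : ∀ {a w} → a ∈ w → 0 < occ _≟_ a w
  ∈⇒occ>0 {a} = List.filter-some (a ≟_)

  ∉⇒occ≡0 : ∀ {a w} → a ∉ w → occ _≟_ a w ≡ 0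
  ∉⇒occ≡0 {a} {w} a∉w = cong length (List.filter-none (a ≟_) (¬Any⇒All¬ w a∉w))

  occ>0⇒∈ : ∀ {a w} → 0 < occ _≟_ a w → a ∈ w
  occ>0⇒∈ {a} {w} occ>0 with a ∈? w
  ... | yes a∈w = a∈w
  ... | no  a∉w = contradiction (∉⇒occ≡0 a∉w) (>⇒≢ occ>0)

  occ≤1⇒Unique : ∀ {w} → (∀ {a} → a ∈ w → occ _≟_ a w ≤ 1) → Unique w
  occ≤1⇒Unique {[]}    _     = []
  occ≤1⇒Unique {x ∷ w} occ≤1 =
    All.tabulate x≢ ∷ occ≤1⇒Unique (λ a∈w → ≤-trans (occ-mono (x ∷ʳ ⊆-refl)) (occ≤1 (there a∈w)))
    where
      x≢ : ∀ {a} → a ∈ w → x ≢ a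
      x≢ a∈w refl = <⇒≱ (subst (1 <_) (sym (occ-∷ x w)) (s≤s (∈⇒occ>0 a∈w))) (occ≤1 (here refl))

  delete : A → List A → List A
  delete x = filter (λ y → ¬? (x ≟ y))

  ∈-delete⁺ : ∀ {x a xs} → a ∈ xs → x ≢ a → a ∈ delete x xs
  ∈-delete⁺ {x} = ∈-filter⁺ (λ y → ¬? (x ≟ y))

  length-delete-< : ∀ {x xs} → x ∈ xs → length (delete x xs) < length xs
  length-delete-< {x} {xs} x∈xs =
    List.filter-notAll (λ y → ¬? (x ≟ y)) xs (Any.map (λ x≡y x≢y → x≢y x≡y) x∈xs)

  length-delete-≤ : ∀ x xs → length (delete x xs) ≤ length xs
  length-delete-≤ x = List.length-filter (λ y → ¬? (x ≟ y))

  record Covers (S D w : List A) : Set where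
    field
      occ≤2   : ∀ a → occ _≟_ a w ≤ 2
      letter  : ∀ {a} → a ∈ w → a ∈ S ⊎ a ∈ D
      doubled : ∀ {a} → 2 ≤ occ _≟_ a w → a ∈ D

  Covers-delete : ∀ {S D u w x} → u ⊆ w → x ∉ u → Covers S D w → Covers (delete x S) (delete x D) u
  Covers-delete {u = u} {x = x} u⊆w x∉u cov = record
    { occ≤2   = λ a → ≤-trans (occ-mono u⊆w) (occ≤2 a)
    ; letter  = λ a∈u → Sum.map (λ a∈S → ∈-delete⁺ a∈S (x≢ a∈u)) (λ a∈D → ∈-delete⁺ a∈D (x≢ a∈u))
                                (letter (lookup u⊆w a∈u))
    ; doubled = λ 2≤occ → ∈-delete⁺ (doubled (≤-trans 2≤occ (occ-mono u⊆w)))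
                                    (x≢ (occ>0⇒∈ (≤-trans (s≤s z≤n) 2≤occ)))
    }
    where
      open Covers cov
      x≢ : ∀ {a} → a ∈ u → x ≢ a
      x≢ a∈u refl = x∉u a∈u

  module _ {S D I R : List A} (cov : Covers S D (I ++ R)) where
    open Covers cov

    private
      I⊆IR : I ⊆ I ++ R
      I⊆IR = ++⁺ʳ R ⊆-refl

    shared-occ≤1 : ∀ {a} → a ∈ R → occ _≟_ a I ≤ 1
    shared-occ≤1 {a} a∈R = ≤-pred (begin
      suc (occ _≟_ a I)           ≡⟨ +-comm 1 (occ _≟_ a I) ⟩
      occ _≟_ a I + 1             ≤⟨ +-monoʳ-≤ (occ _≟_ a I) (∈⇒occ>0 a∈R) ⟩
      occ _≟_ a I + occ _≟_ a R   ≡⟨ occ-++ a I R ⟨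
      occ _≟_ a (I ++ R)          ≤⟨ occ≤2 a ⟩
      2                           ∎)
      where open ≤-Reasoning

    shared-doubled : ∀ {a} → a ∈ I → a ∈ R → a ∈ D
    shared-doubled {a} a∈I a∈R =
      doubled (subst (2 ≤_) (sym (occ-++ a I R)) (+-mono-≤ (∈⇒occ>0 a∈I) (∈⇒occ>0 a∈R)))

    Covers-++ˡ : Covers (S ++ filter (_∈? R) D) (filter (∁? (_∈? R)) D) I
    Covers-++ˡ = record
      { occ≤2   = λ a → ≤-trans (occ-mono I⊆IR) (occ≤2 a)
      ; letter  = λ a∈I → relocate (letter (∈-++⁺ˡ a∈I))
      ; doubled = λ 2≤occ → ∈-filter⁺ (∁? (_∈? R)) (doubled (≤-trans 2≤occ (occ-mono I⊆IR)))
                                      (λ a∈R → <⇒≱ 2≤occ (shared-occ≤1 a∈R))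
      }
      where
        relocate : ∀ {a} → a ∈ S ⊎ a ∈ D → a ∈ S ++ filter (_∈? R) D ⊎ a ∈ filter (∁? (_∈? R)) D
        relocate (inj₁ a∈S) = inj₁ (∈-++⁺ˡ a∈S)
        relocate {a} (inj₂ a∈D) with a ∈? R
        ... | yes a∈R = inj₁ (∈-++⁺ʳ S (∈-filter⁺ (_∈? R) a∈D a∈R))
        ... | no  a∉R = inj₂ (∈-filter⁺ (∁? (_∈? R)) a∈D a∉R)

    length-shared : length (filter (_∈? R) I) ≤ length (filter (_∈? R) D)
    length-shared = Unique-length-≤ _≟_ (occ≤1⇒Unique once) (shared ∘ ∈-filter⁻ (_∈? R) {xs = I})
      where
        once : ∀ {a} → a ∈ filter (_∈? R) I → occ _≟_ a (filter (_∈? R) I) ≤ 1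
        once a∈ = ≤-trans (occ-mono (filter-⊆ (_∈? R) I))
                          (shared-occ≤1 (proj₂ (∈-filter⁻ (_∈? R) {xs = I} a∈)))
        shared : ∀ {a} → a ∈ I × a ∈ R → a ∈ filter (_∈? R) D
        shared (a∈I , a∈R) = ∈-filter⁺ (_∈? R) (shared-doubled a∈I a∈R) a∈R


  Bounded : List A → Set
  Bounded w = ∀ {S D} → Covers S D w → SP _≟_ w + 2 ≤ bound (length S) (length D)

  Bounded-[] : Bounded []
  Bounded-[] {S} {D} _ = *-mono-≤ (m≤n+m 2 (length S)) (m^n>0 2 (length D))

  Bounded-∷-fresh : ∀ {x v} → x ∉ v → Bounded v → Bounded (x ∷ v)
  Bounded-∷-fresh {x} {v} x∉v IH {S} {D} cov = begin
    SP _≟_ (x ∷ v) + 2                                       ≤⟨ +-monoˡ-≤ 2 (SP-∷-fresh x∉v) ⟩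
    suc (SP _≟_ v + 2)                                       ≤⟨ s≤s (IH (Covers-delete (x ∷ʳ ⊆-refl) x∉v cov)) ⟩
    suc (bound (length (delete x S)) (length (delete x D)))  ≤⟨ [ shrinkˡ , shrinkʳ ]′ (letter (here refl)) ⟩
    bound (length S) (length D)                              ∎
    where
      open ≤-Reasoning
      open Covers cov
      shrinkˡ : x ∈ S → bound (length (delete x S)) (length (delete x D)) < bound (length S) (length D)
      shrinkˡ x∈S = bound-monoˡ-< (length-delete-< x∈S) (length-delete-≤ x D)
      shrinkʳ : x ∈ D → bound (length (delete x S)) (length (delete x D)) < bound (length S) (length D)
      shrinkʳ x∈D = bound-monoʳ-< (length-delete-≤ x S) (length-delete-< x∈D)

  Bounded-doubled : ∀ {x I R} → x ∉ I → Bounded (I ++ R) → Bounded I → Bounded (x ∷ I ++ x ∷ R)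
  Bounded-doubled {x} {I} {R} x∉I IH-IR IH-I {S} {D} cov =
    ≤-trans (bound-doubled {length S₀} {length D₁} {length D₂}
                           IR-bound I-bound (length-shared {I = I} {R} cov′) (SP-doubled x∉I x∉R))
            (bound-mono-≤ (length-delete-≤ x S) D-shrinks)
    where
      open Covers cov
      w = x ∷ I ++ x ∷ R
      S₀ = delete x S
      D₀ = delete x D
      D₁ = filter (_∈? R) D₀
      D₂ = filter (∁? (_∈? R)) D₀

      occ-x : suc (suc (occ _≟_ x R)) ≤ occ _≟_ x w
      occ-x = subst (_≤ occ _≟_ x w) (trans (occ-∷ x (x ∷ R)) (cong suc (occ-∷ x R)))
                    (occ-mono (refl ∷ ++⁺ˡ I ⊆-refl))

      x∉R : x ∉ R
      x∉R x∈R = <⇒≱ (≤-trans (s≤s (s≤s (∈⇒occ>0 x∈R))) occ-x) (occ≤2 x)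

      x∈D : x ∈ D
      x∈D = doubled (≤-trans (s≤s (s≤s z≤n)) occ-x)

      cov′ : Covers S₀ D₀ (I ++ R)
      cov′ = Covers-delete (x ∷ʳ ++⁺ ⊆-refl (x ∷ʳ ⊆-refl)) ([ x∉I , x∉R ]′ ∘ ∈-++⁻ I) cov

      split : length D₁ + length D₂ ≡ length D₀
      split = length-filter-∁ (_∈? R) D₀

      IR-bound : SP _≟_ (I ++ R) + 2 ≤ bound (length S₀) (length D₁ + length D₂)
      IR-bound = subst (λ d → SP _≟_ (I ++ R) + 2 ≤ bound (length S₀) d) (sym split) (IH-IR cov′)

      I-bound : SP _≟_ I + 2 ≤ bound (length S₀ + length D₁) (length D₂)
      I-bound = subst (λ s → SP _≟_ I + 2 ≤ bound s (length D₂)) (List.length-++ S₀)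
                      (IH-I (Covers-++ˡ {I = I} cov′))

      D-shrinks : suc (length D₁ + length D₂) ≤ length D
      D-shrinks = subst (λ d → suc d ≤ length D) (sym split) (length-delete-< x∈D)

  bounded : ∀ w → Acc _<_ (length w) → Bounded w
  bounded []      _         = Bounded-[]
  bounded (x ∷ v) (acc rec) with x ∈? v
  ... | no  x∉v = Bounded-∷-fresh x∉v (bounded v (rec ≤-refl))
  ... | yes x∈v with I , R , refl , x∉I ← ∈-∃++-first _≟_ x∈v =
    Bounded-doubled x∉I (bounded (I ++ R) (rec (shorter (++⁺ ⊆-refl (x ∷ʳ ⊆-refl)))))
                        (bounded I (rec (shorter (++⁺ʳ (x ∷ R) ⊆-refl))))
    where
      shorter : ∀ {u} → u ⊆ I ++ x ∷ R → length u < length (x ∷ I ++ x ∷ R)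
      shorter u⊆ = s≤s (length-mono-≤ u⊆)

  SP+2≤bound : ∀ {S D} w → Covers S D w → SP _≟_ w + 2 ≤ bound (length S) (length D)
  SP+2≤bound w = bounded w (<-wellFounded (length w))

proposition5p1 : (q : ℕ) → 1 ≤ q → {Σ : Set} → (_≟_ : DecidableEquality Σ) →
    (w : List Σ) → length w ≡ 2 * q →
    length (deduplicate _≟_ w) ≡ q →
    (∀ a → a ∈ w → occ _≟_ a w ≡ 2) →
    SP _≟_ w ≤ 2 ^ (q + 1) ∸ 2
proposition5p1 q _ _≟_ w _ length-letters twice =
  m+n≤o⇒m≤o∸n (SP _≟_ w) (subst (λ n → SP _≟_ w + 2 ≤ 2 ^ n) (+-comm 1 q)
    (subst (λ d → SP _≟_ w + 2 ≤ bound 0 d) length-letters (SP+2≤bound _≟_ w cover)))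
  where
    open import Data.List.Membership.DecPropositional _≟_ using (_∈?_)
    letters = deduplicate _≟_ w
    ∈-letters : ∀ {a} → a ∈ w → a ∈ letters
    ∈-letters = Anyₚ.deduplicate⁺ _≟_ (λ b≡c a≡b → trans a≡b (sym b≡c))
    occ≤2 : ∀ a → occ _≟_ a w ≤ 2
    occ≤2 a with a ∈? w
    ... | yes a∈w = ≤-reflexive (twice a a∈w)
    ... | no  a∉w = subst (_≤ 2) (sym (∉⇒occ≡0 _≟_ a∉w)) z≤n
    cover : Covers _≟_ [] letters w
    cover = record
      { occ≤2   = occ≤2
      ; letter  = inj₂ ∘ ∈-letters
      ; doubled = ∈-letters ∘ occ>0⇒∈ _≟_ ∘ ≤-trans (s≤s z≤n)
      }
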